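{- Let $t\in\mathbb{N}$, let $G$ be a finite simple graph with positive integer vertex weights, and let $v\in V(G)$ have weight $t$. Let $G(v)$ be the weighted graph obtained from $G$ by replacing $v$ with $t$ pairwise non-adjacent new vertices $v_1,\dots,v_t$, each of weight $1$, where each $v_j$ is adjacent to exactly the vertices that were adjacent to $v$ in $G$; all other vertices, weights and edges are unchanged. Then weighted Grim played on $G$ and weighted Grim played on $G(v)$ have the same outcome: $G$ is an $\mathcal{N}$ position if and only if $G(v)$ is an $\mathcal{N}$ position.
   Context: Weighted Grim: two players alternate moves on a finite simple undirected graph whose vertices carry positive integer weights. A move consists of selecting a remaining vertex. A vertex of weight $t$ is deleted (together with all its incident edges) once it has been selected $t$ times; in addition, whenever a vertex becomes isolated it is deleted immediately (isolated vertices are also deleted before play starts). The player who makes the last legal move wins; a player with no available move loses. A position is an $\mathcal{N}$ position if the player about to move has a winning strategy, and a $\mathcal{P}$ position otherwise. When all weights equal $1$ this is ordinary Grim: a move deletes a vertex with its incident edges and then deletes all vertices that became isolated. -}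

module Defs where

open import Data.Nat using (ℕ; zero; suc; _+_; _∸_; _≤_; _<ᵇ_; s≤s; z≤n)
open import Data.Bool using (Bool; true; false; if_then_else_; _∧_)
open import Data.Fin using (Fin; _≟_; punchIn; splitAt)
open import Data.List using (allFin)
open import Data.Bool.ListAction using (any)
open import Data.Sum using (_⊎_; inj₁; inj₂)
open import Relation.Nullary.Decidable using (⌊_⌋)
open import Relation.Binary.PropositionalEquality using (_≡_; refl)

record WGraph (n : ℕ) : Set where
  field
    adj    : Fin n → Fin n → Bool
    wt     : Fin n → ℕ
    adj-sym    : ∀ i j → adj i j ≡ adj j i
    adj-irrefl : ∀ i → adj i i ≡ false
    wt-pos     : ∀ i → 1 ≤ wt i
open WGraph public

-- Game states: r i = number of selections still needed to delete vertex i;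
-- r i = 0 means vertex i has been deleted.  Edges are those of the
-- original graph between undeleted vertices.
State : ℕ → Set
State n = Fin n → ℕ

live : ∀ {n} → State n → Fin n → Bool
live r k = 0 <ᵇ r k

hasNbr : ∀ {n} → (Fin n → Fin n → Bool) → State n → Fin n → Bool
hasNbr {n} a r j = any (λ k → a j k ∧ live r k) (allFin n)

-- delete all isolated vertices (deleting an isolated vertex cannot make
-- another vertex isolated, so one pass suffices)
clean : ∀ {n} → (Fin n → Fin n → Bool) → State n → State n
clean a r j = if hasNbr a r j then r j else 0

select : ∀ {n} → State n → Fin n → State n
select r i j = if ⌊ j ≟ i ⌋ then r j ∸ 1 else r j

move : ∀ {n} → (Fin n → Fin n → Bool) → State n → Fin n → State n
move a r i = clean a (select r i)

data Win  {n : ℕ} (a : Fin n → Fin n → Bool) (r : State n) : Set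
data Lose {n : ℕ} (a : Fin n → Fin n → Bool) (r : State n) : Set

data Win a r where
  win : (i : Fin _) → 1 ≤ r i → Lose a (move a r i) → Win a r

data Lose a r where
  lose : (∀ i → 1 ≤ r i → Win a (move a r i)) → Lose a r

start : ∀ {n} → WGraph n → State n
start G = clean (adj G) (wt G)

IsN : ∀ {n} → WGraph n → Set
IsN G = Win (adj G) (start G)

-- G(v): vertex set Fin (m + t), t = wt G v; inj₁ i ↦ old vertex punchIn v i
-- (i.e. all vertices other than v), inj₂ j ↦ new vertex v_(j+1) of weight 1
-- adjacent exactly to the old neighbours of v.
splitAdj : ∀ {m} (G : WGraph (suc m)) (v : Fin (suc m)) →
           Fin (m + wt G v) → Fin (m + wt G v) → Bool
splitAdj {m} G v x y with splitAt m x | splitAt m y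
... | inj₁ i | inj₁ i' = adj G (punchIn v i) (punchIn v i')
... | inj₁ i | inj₂ _  = adj G (punchIn v i) v
... | inj₂ _ | inj₁ i' = adj G v (punchIn v i')
... | inj₂ _ | inj₂ _  = false

splitWt : ∀ {m} (G : WGraph (suc m)) (v : Fin (suc m)) → Fin (m + wt G v) → ℕ
splitWt {m} G v x with splitAt m x
... | inj₁ i = wt G (punchIn v i)
... | inj₂ _ = 1

splitSym : ∀ {m} (G : WGraph (suc m)) (v : Fin (suc m)) x y →
           splitAdj G v x y ≡ splitAdj G v y x
splitSym {m} G v x y with splitAt m x | splitAt m y
... | inj₁ i | inj₁ i' = adj-sym G (punchIn v i) (punchIn v i')
... | inj₁ i | inj₂ _  = adj-sym G (punchIn v i) v
... | inj₂ _ | inj₁ i' = adj-sym G v (punchIn v i')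
... | inj₂ _ | inj₂ _  = refl

splitIrr : ∀ {m} (G : WGraph (suc m)) (v : Fin (suc m)) x → splitAdj G v x x ≡ false
splitIrr {m} G v x with splitAt m x
... | inj₁ i = adj-irrefl G (punchIn v i)
... | inj₂ _ = refl

splitPos : ∀ {m} (G : WGraph (suc m)) (v : Fin (suc m)) x → 1 ≤ splitWt G v x
splitPos {m} G v x with splitAt m x
... | inj₁ i = wt-pos G (punchIn v i)
... | inj₂ _ = s≤s z≤n

splitG : ∀ {m} (G : WGraph (suc m)) (v : Fin (suc m)) → WGraph (m + wt G v)
splitG G v = record
  { adj = splitAdj G v ; wt = splitWt G v
  ; adj-sym = splitSym G v ; adj-irrefl = splitIrr G v ; wt-pos = splitPos G v }

-- The weight t of v counts the selections v can still absorb, and t clones of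
-- weight 1 can absorb exactly as many, one per surviving clone.  So relate a
-- position of G to a position of G(v) when they agree off v and the counter of v
-- equals the number of surviving clones.  Selecting v corresponds to selecting
-- any surviving clone and vice versa, and since adjacency in G(v) is pulled back
-- from G along the map sending every clone to v, the cleanup of isolated
-- vertices acts in the same way on both sides.  The relation is therefore a
-- bisimulation, and bisimilar positions have the same outcome.
module Submission where

open import Defs
open import Data.Nat using (ℕ; suc)
open import Data.Fin using (Fin)
open import Function.Bundles using (_⇔_)

open import Data.Bool using (Bool; true; false; if_then_else_)
open import Data.Bool.Properties using (T-≡; T-∧; ⇔→≡)
open import Data.Fin as Fin using (zero; suc; punchIn; splitAt; _↑ˡ_; _↑ʳ_; _≟_)
open import Data.Fin.Properties using (splitAt-↑ˡ; splitAt-↑ʳ; splitAt⁻¹-↑ˡ; splitAt⁻¹-↑ʳ;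
  ↑ˡ-injective; ↑ʳ-injective; punchIn-injective; punchInᵢ≢i; punchIn-punchOut; suc-injective)
open import Data.List using (allFin)
open import Data.List.Membership.Propositional renaming (lose to any-witness) using ()
open import Data.List.Membership.Propositional.Properties using (∈-allFin)
open import Data.List.Relation.Unary.Any using (satisfied)
open import Data.List.Relation.Unary.Any.Properties using (any⁺; any⁻)
open import Data.Nat using (zero; _+_; _∸_; _≤_; s≤s; z≤n)
open import Data.Nat.Properties using (≤-trans; m≤m+n; m≤n+m; +-∸-assoc; <ᵇ⇒<; <⇒<ᵇ; +-0-monoid)
open import Algebra.Properties.Monoid.Sum +-0-monoid using (sum; sum-cong-≗; sum-replicate-zero)
open import Data.Product using (_×_; _,_; ∃-syntax)
open import Data.Sum using (inj₁; inj₂)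
open import Function using (_∘_)
open import Function.Bundles using (mk⇔; Equivalence)
import Function.Properties.Equivalence as ⇔
open import Relation.Nullary using (¬_; yes; no; contradiction)
open import Relation.Binary.PropositionalEquality
  using (_≡_; refl; sym; trans; cong; cong₂; subst; module ≡-Reasoning)

Adjacency : ℕ → Set
Adjacency n = Fin n → Fin n → Bool

record Bisimulation {n k : ℕ} (a : Adjacency n) (b : Adjacency k) : Set₁ where
  field
    _∼_   : State n → State k → Set
    forth : ∀ {r s} → r ∼ s → ∀ x → 1 ≤ r x →
            ∃[ y ] 1 ≤ s y × move a r x ∼ move b s y
    back  : ∀ {r s} → r ∼ s → ∀ y → 1 ≤ s y →
            ∃[ x ] 1 ≤ r x × move a r x ∼ move b s y

converse : ∀ {n k} {a : Adjacency n} {b : Adjacency k} → Bisimulation a b → Bisimulation b a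
converse B = record { _∼_ = λ s r → r ∼ s ; forth = back ; back = forth }
  where open Bisimulation B

module _ {n k} {a : Adjacency n} {b : Adjacency k} (B : Bisimulation a b) where
  open Bisimulation B

  Win-transfer  : ∀ {r s} → r ∼ s → Win a r → Win b s
  Lose-transfer : ∀ {r s} → r ∼ s → Lose a r → Lose b s
  Win-transfer r∼s (win x live l) =
    let y , live′ , next∼ = forth r∼s x live in win y live′ (Lose-transfer next∼ l)
  Lose-transfer r∼s (lose w) = lose λ y live →
    let x , live′ , next∼ = back r∼s y live in Win-transfer next∼ (w x live′)

Win-bisim : ∀ {n k} {a : Adjacency n} {b : Adjacency k} (B : Bisimulation a b) →
            ∀ {r s} → Bisimulation._∼_ B r s → Win a r ⇔ Win b s
Win-bisim B r∼s = mk⇔ (Win-transfer B r∼s) (Win-transfer (converse B) r∼s)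

sum-≥ : ∀ {n} (f : Fin n → ℕ) i → f i ≤ sum f
sum-≥ f zero    = m≤m+n (f zero) _
sum-≥ f (suc i) = ≤-trans (sum-≥ (f ∘ suc) i) (m≤n+m _ (f zero))

sum-positive : ∀ {n} (f : Fin n → ℕ) → 1 ≤ sum f → ∃[ i ] 1 ≤ f i
sum-positive {suc n} f pos with f zero in eq
... | suc _ = zero , subst (1 ≤_) (sym eq) (s≤s z≤n)
... | zero  = let i , pos′ = sum-positive (f ∘ suc) pos in suc i , pos′

sum-ones : ∀ n → sum {n} (λ _ → 1) ≡ n
sum-ones zero    = refl
sum-ones (suc n) = cong suc (sum-ones n)

sum-if : ∀ n c (f : Fin n → ℕ) → sum (λ i → if c then f i else 0) ≡ (if c then sum f else 0)
sum-if n true  f = refl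
sum-if n false f = sum-replicate-zero n

select-≢ : ∀ {n} (s : State n) {x y} → ¬ y ≡ x → select s x y ≡ s y
select-≢ s {x} {y} y≢x with y ≟ x
... | yes y≡x = contradiction y≡x y≢x
... | no _    = refl

select-self : ∀ {n} (s : State n) x → select s x x ≡ s x ∸ 1
select-self s x with x ≟ x
... | yes _   = refl
... | no x≢x = contradiction refl x≢x

select-respects : ∀ {n k} (s : State n) (r : State k) {x y x′ y′} →
                  (y ≡ x ⇔ y′ ≡ x′) → s y ≡ r y′ → select s x y ≡ select r x′ y′
select-respects s r {x} {y} {x′} {y′} y≡x⇔ s≡r with y ≟ x | y′ ≟ x′
... | yes _   | yes _     = cong (_∸ 1) s≡r
... | no _    | no _      = s≡r
... | yes y≡x | no y′≢x′ = contradiction (Equivalence.to y≡x⇔ y≡x) y′≢x′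
... | no y≢x  | yes y′≡x′ = contradiction (Equivalence.from y≡x⇔ y′≡x′) y≢x

suc-≡⇔ : ∀ {n} {i j : Fin n} → suc i ≡ suc j ⇔ i ≡ j
suc-≡⇔ = mk⇔ suc-injective (cong suc)

sum-select : ∀ {n} (f : State n) i → 1 ≤ f i → sum (select f i) ≡ sum f ∸ 1
sum-select {suc n} f zero pos with f zero
... | suc _ = cong (_ +_) (sum-cong-≗ (λ k → select-≢ f {zero} {suc k} λ ()))
sum-select {suc n} f (suc i) pos = begin
  f zero + sum (select f (suc i) ∘ suc)  ≡⟨ cong (f zero +_) (sum-cong-≗ {n} λ k →
                                              select-respects f (f ∘ suc) {suc i} {suc k} suc-≡⇔ refl) ⟩
  f zero + sum (select (f ∘ suc) i)      ≡⟨ cong (f zero +_) (sum-select (f ∘ suc) i pos) ⟩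
  f zero + (sum (f ∘ suc) ∸ 1)           ≡⟨ sym (+-∸-assoc (f zero) (≤-trans pos (sum-≥ (f ∘ suc) i))) ⟩
  sum f ∸ 1                              ∎
  where open ≡-Reasoning

hasNbr≡true⇔ : ∀ {n} (a : Adjacency n) (r : State n) j →
               hasNbr a r j ≡ true ⇔ (∃[ k ] a j k ≡ true × 1 ≤ r k)
hasNbr≡true⇔ {n} a r j = mk⇔ to from
  where
  to : hasNbr a r j ≡ true → ∃[ k ] a j k ≡ true × 1 ≤ r k
  to has with k , adj∧live ← satisfied (any⁻ _ (allFin n) (Equivalence.from T-≡ has)) =
    let adj , live = Equivalence.to T-∧ adj∧live in
    k , Equivalence.to T-≡ adj , <ᵇ⇒< 0 (r k) live
  from : ∃[ k ] a j k ≡ true × 1 ≤ r k → hasNbr a r j ≡ true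
  from (k , adj , live) = Equivalence.to T-≡ (any⁺ _ (any-witness (∈-allFin k)
    (Equivalence.from T-∧ (Equivalence.from T-≡ adj , <⇒<ᵇ live))))

hasNbr-pullback : ∀ {n k} {a : Adjacency n} {b : Adjacency k} (π : Fin n → Fin k) {s r} →
                  (∀ x y → a x y ≡ b (π x) (π y)) →
                  (∀ x → 1 ≤ s x → 1 ≤ r (π x)) →
                  (∀ y → 1 ≤ r y → ∃[ x ] π x ≡ y × 1 ≤ s x) →
                  ∀ x → hasNbr a s x ≡ hasNbr b r (π x)
hasNbr-pullback {a = a} {b} π {s} {r} a≡b live-π live-lift x =
  ⇔→≡ (⇔.trans (hasNbr≡true⇔ a s x) (⇔.trans (mk⇔ to from) (⇔.sym (hasNbr≡true⇔ b r (π x)))))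
  where
  to : ∃[ y ] a x y ≡ true × 1 ≤ s y → ∃[ y ] b (π x) y ≡ true × 1 ≤ r y
  to (y , adj , live) = π y , trans (sym (a≡b x y)) adj , live-π y live
  from : ∃[ y ] b (π x) y ≡ true × 1 ≤ r y → ∃[ y ] a x y ≡ true × 1 ≤ s y
  from (y , adj , live) with x′ , refl , live′ ← live-lift y live = x′ , trans (a≡b x x′) adj , live′

module Split {m} (G : WGraph (suc m)) (v : Fin (suc m)) where

  t : ℕ
  t = wt G v

  π : Fin (m + t) → Fin (suc m)
  π x with splitAt m x
  ... | inj₁ i = punchIn v i
  ... | inj₂ _ = v

  π-old : ∀ i → π (i ↑ˡ t) ≡ punchIn v i
  π-old i rewrite splitAt-↑ˡ m i t = refl

  π-clone : ∀ j → π (m ↑ʳ j) ≡ v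
  π-clone j rewrite splitAt-↑ʳ m t j = refl

  splitAdj-π : ∀ x y → splitAdj G v x y ≡ adj G (π x) (π y)
  splitAdj-π x y with splitAt m x | splitAt m y
  ... | inj₁ _ | inj₁ _ = refl
  ... | inj₁ _ | inj₂ _ = refl
  ... | inj₂ _ | inj₁ _ = refl
  ... | inj₂ _ | inj₂ _ = sym (adj-irrefl G v)

  ↑ˡ≢↑ʳ : ∀ i j → ¬ i ↑ˡ t ≡ m ↑ʳ j
  ↑ˡ≢↑ʳ i j eq with trans (sym (splitAt-↑ˡ m i t)) (trans (cong (splitAt m) eq) (splitAt-↑ʳ m t j))
  ... | ()

  data SplitVertex : Fin (m + t) → Set where
    old   : ∀ i → SplitVertex (i ↑ˡ t)
    clone : ∀ j → SplitVertex (m ↑ʳ j)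

  splitVertex : ∀ x → SplitVertex x
  splitVertex x with splitAt m x in eq
  ... | inj₁ i = subst SplitVertex (splitAt⁻¹-↑ˡ eq) (old i)
  ... | inj₂ j = subst SplitVertex (splitAt⁻¹-↑ʳ eq) (clone j)

  data OriginalVertex : Fin (suc m) → Set where
    split : OriginalVertex v
    other : ∀ i → OriginalVertex (punchIn v i)

  originalVertex : ∀ y → OriginalVertex y
  originalVertex y with v ≟ y
  ... | yes refl = split
  ... | no v≢y   = subst OriginalVertex (punchIn-punchOut v≢y) (other (Fin.punchOut v≢y))

  clones : State (m + t) → State t
  clones s j = s (m ↑ʳ j)

  record Collapse (r : State (suc m)) (s : State (m + t)) : Set where
    field
      agree : ∀ i → r (punchIn v i) ≡ s (i ↑ˡ t)
      count : r v ≡ sum (clones s)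
  open Collapse

  module _ {r s} (c : Collapse r s) where

    live-π : ∀ x → 1 ≤ s x → 1 ≤ r (π x)
    live-π x live with splitVertex x
    ... | old i   rewrite π-old i   | agree c i = live
    ... | clone j rewrite π-clone j | count c   = ≤-trans live (sum-≥ (clones s) j)

    live-lift : ∀ y → 1 ≤ r y → ∃[ x ] π x ≡ y × 1 ≤ s x
    live-lift y live with originalVertex y
    ... | split   = let j , live′ = sum-positive (clones s) (subst (1 ≤_) (count c) live) in
                    m ↑ʳ j , π-clone j , live′
    ... | other i = i ↑ˡ t , π-old i , subst (1 ≤_) (agree c i) live

    hasNbr-π : ∀ x {y} → π x ≡ y → hasNbr (splitAdj G v) s x ≡ hasNbr (adj G) r y
    hasNbr-π x refl = hasNbr-pullback {a = splitAdj G v} {adj G} π splitAdj-π live-π live-lift x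

    clean-Collapse : Collapse (clean (adj G) r) (clean (splitAdj G v) s)
    agree clean-Collapse i =
      cong₂ (λ b n → if b then n else 0) (sym (hasNbr-π (i ↑ˡ t) (π-old i))) (agree c i)
    count clean-Collapse = begin
      (if hasNbr (adj G) r v then r v else 0)
        ≡⟨ cong (λ n → if _ then n else 0) (count c) ⟩
      (if hasNbr (adj G) r v then sum (clones s) else 0)
        ≡⟨ sym (sum-if t _ (clones s)) ⟩
      sum (λ j → if hasNbr (adj G) r v then clones s j else 0)
        ≡⟨ sum-cong-≗ {t} (λ j → cong (λ b → if b then clones s j else 0)
                                      (sym (hasNbr-π (m ↑ʳ j) (π-clone j)))) ⟩
      sum (clones (clean (splitAdj G v) s))
        ∎
      where open ≡-Reasoning

    select-old : ∀ i → Collapse (select r (punchIn v i)) (select s (i ↑ˡ t))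
    agree (select-old i) i′ =
      select-respects r s
        (mk⇔ (cong (_↑ˡ t) ∘ punchIn-injective v i′ i) (cong (punchIn v) ∘ ↑ˡ-injective t i′ i))
        (agree c i′)
    count (select-old i) = begin
      select r (punchIn v i) v   ≡⟨ select-≢ r (punchInᵢ≢i v i ∘ sym) ⟩
      r v                        ≡⟨ count c ⟩
      sum (clones s)             ≡⟨ sum-cong-≗ {t} (λ j → sym (select-≢ s (↑ˡ≢↑ʳ i j ∘ sym))) ⟩
      sum (clones (select s (i ↑ˡ t))) ∎
      where open ≡-Reasoning

    select-clone : ∀ j → 1 ≤ s (m ↑ʳ j) → Collapse (select r v) (select s (m ↑ʳ j))
    agree (select-clone j _) i = begin
      select r v (punchIn v i)   ≡⟨ select-≢ r (punchInᵢ≢i v i) ⟩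
      r (punchIn v i)            ≡⟨ agree c i ⟩
      s (i ↑ˡ t)                 ≡⟨ sym (select-≢ s (↑ˡ≢↑ʳ i j)) ⟩
      select s (m ↑ʳ j) (i ↑ˡ t) ∎
      where open ≡-Reasoning
    count (select-clone j live) = begin
      select r v v                   ≡⟨ select-self r v ⟩
      r v ∸ 1                        ≡⟨ cong (_∸ 1) (count c) ⟩
      sum (clones s) ∸ 1             ≡⟨ sym (sum-select (clones s) j live) ⟩
      sum (select (clones s) j)      ≡⟨ sum-cong-≗ {t} (λ j′ → select-respects (clones s) s
                                          (mk⇔ (cong (m ↑ʳ_)) (↑ʳ-injective m j′ j)) refl) ⟩
      sum (clones (select s (m ↑ʳ j))) ∎
      where open ≡-Reasoning

  move-Collapse : ∀ {r s} → Collapse r s → ∀ x → 1 ≤ s x →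
                  Collapse (move (adj G) r (π x)) (move (splitAdj G v) s x)
  move-Collapse c x live with splitVertex x
  ... | old i   rewrite π-old i   = clean-Collapse (select-old c i)
  ... | clone j rewrite π-clone j = clean-Collapse (select-clone c j live)

  collapse-bisim : Bisimulation (adj G) (splitAdj G v)
  collapse-bisim = record { _∼_ = Collapse ; forth = forth ; back = back }
    where
    forth : ∀ {r s} → Collapse r s → ∀ y → 1 ≤ r y →
            ∃[ x ] 1 ≤ s x × Collapse (move (adj G) r y) (move (splitAdj G v) s x)
    forth c y live with x , refl , live′ ← live-lift c y live = x , live′ , move-Collapse c x live′
    back : ∀ {r s} → Collapse r s → ∀ x → 1 ≤ s x →
           ∃[ y ] 1 ≤ r y × Collapse (move (adj G) r y) (move (splitAdj G v) s x)
    back c x live = π x , live-π c x live , move-Collapse c x live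

  start-Collapse : Collapse (start G) (start (splitG G v))
  start-Collapse = clean-Collapse weights
    where
    weights : Collapse (wt G) (splitWt G v)
    agree weights i rewrite splitAt-↑ˡ m i t = refl
    count weights = sym (trans (sum-cong-≗ {t} clone-weight) (sum-ones t))
      where
      clone-weight : ∀ j → splitWt G v (m ↑ʳ j) ≡ 1
      clone-weight j rewrite splitAt-↑ʳ m t j = refl

lemma2p2 : ∀ {m : ℕ} (G : WGraph (suc m)) (v : Fin (suc m)) → IsN G ⇔ IsN (splitG G v)
lemma2p2 G v = Win-bisim (collapse-bisim G v) (start-Collapse G v)
  where open Split
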